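{- Fix $h,k>0$ and a nonempty partition $\mu$ with $h_\mu\le h$. Then $$\mathcal{P}(\mu,k)=\bigcup_{\alpha\in\mathcal{P}(h,k)}\mathcal{Q}(\mu+\alpha).$$
   Context: A partition is a weakly decreasing sequence $\mu=(\mu_1,\mu_2,\ldots)$ of nonnegative integers with finitely many positive terms, identified with its Ferrers board; height $h_\mu$ = number of positive parts, width $w_\mu=\mu_1$; nonempty means $\mu_1>0$. A partition $\alpha$ contains $\mu$ if deleting some rows and some columns of the Ferrers board of $\alpha$ yields that of $\mu$. $\mathcal{P}(\mu,k)$ is the set of partitions of width $w_\mu+k$ that contain $\mu$. $\mathcal{P}(h,k)$ is the set of partitions $\alpha$ with $h_\alpha\le h$ and $w_\alpha=k$. The sum of partitions is $\mu+\alpha=(\mu_1+\alpha_1,\mu_2+\alpha_2,\ldots)$. For a partition $\beta$, $\mathcal{Q}(\beta)$ is the set of all partitions obtained from $\beta$ by adding an arbitrary (finite) number of parts, each no larger than $w_\beta$. -}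

module Defs where

open import Data.Nat using (ℕ; zero; suc; _+_; _≤_; _<_; _≥_)
open import Data.Fin using (Fin; toℕ) renaming (_<_ to _<ᶠ_)
open import Data.List using (List; []; _∷_; length; _++_)
open import Data.List.Relation.Unary.All using (All)
open import Data.List.Relation.Unary.Linked using (Linked)
open import Data.List.Relation.Binary.Permutation.Propositional using (_↭_)
open import Data.Product using (Σ; ∃; _×_)
open import Relation.Binary.PropositionalEquality using (_≡_)
open import Function.Bundles using (_⇔_)

-- A partition is represented by the list of its positive parts, weakly decreasing.
-- (This representation is canonical: equal partitions are equal lists.)
IsPartition : List ℕ → Set
IsPartition l = All (λ x → 0 < x) l × Linked _≥_ l

-- i-th part (0-indexed), 0 beyond the height
part : List ℕ → ℕ → ℕ
part []       _       = 0
part (x ∷ _)  zero    = x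
part (_ ∷ xs) (suc i) = part xs i

height : List ℕ → ℕ
height = length

width : List ℕ → ℕ
width []      = 0
width (x ∷ _) = x

_⊕_ : List ℕ → List ℕ → List ℕ
[]       ⊕ ys       = ys
(x ∷ xs) ⊕ []       = x ∷ xs
(x ∷ xs) ⊕ (y ∷ ys) = (x + y) ∷ (xs ⊕ ys)

StrictlyIncreasing : {n : ℕ} → (Fin n → ℕ) → Set
StrictlyIncreasing {n} f = (a b : Fin n) → a <ᶠ b → f a < f b

-- α contains μ: deleting some rows and some columns of the Ferrers board of α
-- yields the Ferrers board of μ, i.e. there are kept rows r(0)<…<r(h_μ-1) and
-- kept columns c(0)<…<c(w_μ-1) such that cell (r a, c b) is in α iff (a,b) is in μ.
-- The Ferrers board of λ is {(i,j) | j < part λ i}.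
Contains : List ℕ → List ℕ → Set
Contains α μ =
  Σ (Fin (height μ) → ℕ) λ r → Σ (Fin (width μ) → ℕ) λ c →
    StrictlyIncreasing r × StrictlyIncreasing c ×
    ((a : Fin (height μ)) (b : Fin (width μ)) →
       (c b < part α (r a)) ⇔ (toℕ b < part μ (toℕ a)))

InPμk : List ℕ → ℕ → List ℕ → Set
InPμk μ k β = IsPartition β × width β ≡ width μ + k × Contains β μ

InPhk : ℕ → ℕ → List ℕ → Set
InPhk h k α = IsPartition α × height α ≤ h × width α ≡ k

InQ : List ℕ → List ℕ → Set
InQ β γ = IsPartition γ × ∃ λ (ν : List ℕ) → All (λ x → x ≤ width β) ν × (γ ↭ (β ++ ν))

module Submission where

-- (⊇) If β ∈ 𝒬(μ + α) then, β being sorted, μ + α is a sublist of β.  The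
-- partition μ embeds into μ + α using every row and sending column b to
-- b + α_{μ′_b}, where μ′_b (the conjugate partition) counts the parts of μ
-- exceeding b; composing with the sublist gives μ ⊆ β, and β has width w_μ + k.
--
-- (⊆) If μ embeds into β with width w_μ + k, take the first kept row to be the
-- top one and let e_a = β_{row a} − μ_a.  Increasing columns force e to be
-- decreasing, so α = (e_a without zeros) ∈ 𝒫(h,k), μ + α is the sublist of kept
-- rows of β, and the remaining parts of β are at most the width w_μ + k.

open import Defs
open import Data.Nat using (>-nonZero; ℕ; zero; suc; pred; _+_; _∸_; _≤_; _<_; _≥_; z≤n; s≤s; s≤s⁻¹; _≟_; _<?_)
open import Data.Nat.Properties
open import Data.List using (List; []; _∷_; length; _++_; applyUpTo; filter)
open import Data.List.Properties using (length-applyUpTo; length-filter; filter-accept; filter-reject)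
open import Data.List.Relation.Unary.All as All using (All; []; _∷_)
open import Data.List.Relation.Unary.All.Properties using (all-filter; ++⁺; ++⁻ʳ)
open import Data.List.Relation.Unary.Linked as Linked using (Linked; []; [-]; _∷_)
open import Data.List.Relation.Unary.Linked.Properties using (Linked⇒All; applyUpTo⁺₁; filter⁺)
open import Data.List.Relation.Binary.Sublist.Propositional {A = ℕ} using (_⊆_; []; _∷_; _∷ʳ_; minimum)
open import Data.List.Relation.Binary.Sublist.Propositional.Properties using (All-resp-⊆)
open import Data.List.Relation.Binary.Permutation.Propositional using (_↭_; ↭-refl; ↭-sym; ↭-trans; prep; swap)
open import Data.List.Relation.Binary.Permutation.Propositional.Properties using (drop-∷; shift; ++⁺ˡ; ∈-resp-↭; ¬x∷xs↭[]; All-resp-↭)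
open import Data.List.Membership.Propositional using (_∈_)
open import Data.List.Membership.Propositional.Properties using (∈-++⁻)
open import Data.List.Relation.Unary.Any using (here; there)
open import Data.Fin using (Fin; toℕ; fromℕ<)
open import Data.Fin.Properties using (toℕ-fromℕ<; toℕ<n)
open import Function.Bundles using (_⇔_; mk⇔; Equivalence)
open import Data.Product using (Σ; ∃; _×_; _,_; proj₁; proj₂)
open import Data.Sum using (inj₁; inj₂)
open import Relation.Nullary using (yes; no; contradiction)
open import Relation.Nullary.Decidable using (decidable-stable)
open import Relation.Binary.PropositionalEquality using (_≡_; refl; sym; trans; cong; cong₂; subst; subst₂; module ≡-Reasoning)

Sorted : List ℕ → Set
Sorted = Linked _≥_

∸-cross : ∀ {x y m m'} → x + m ≤ y + m' → x ∸ m' ≤ y ∸ m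
∸-cross {x} {y} {m} {m'} le = begin
  x ∸ m'                ≡⟨ [m+n]∸[m+o]≡n∸o m x m' ⟨
  (m + x) ∸ (m + m')    ≤⟨ ∸-monoˡ-≤ (m + m') (subst₂ _≤_ (+-comm x m) (+-comm y m') le) ⟩
  (m' + y) ∸ (m + m')   ≡⟨ cong ((m' + y) ∸_) (+-comm m m') ⟩
  (m' + y) ∸ (m' + m)   ≡⟨ [m+n]∸[m+o]≡n∸o m' y m ⟩
  y ∸ m                 ∎
  where open ≤-Reasoning

IncreasingOn : ℕ → (ℕ → ℕ) → Set
IncreasingOn n f = ∀ {i j} → i < j → j < n → f i < f j

-- A strictly increasing function grows at least as fast as the identity:
-- f j - f i ≥ j - i, written without subtraction.
increasing-spread : ∀ {n f i j} → IncreasingOn n f → i ≤ j → j < n → f i + j ≤ f j + i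
increasing-spread {j = zero} _ z≤n _ = ≤-refl
increasing-spread {f = f} {i} {suc j} inc i≤1+j 1+j<n with m≤n⇒m<n∨m≡n i≤1+j
... | inj₂ refl = ≤-refl
... | inj₁ i<1+j = begin
  f i + suc j        ≡⟨ +-suc (f i) j ⟩
  suc (f i + j)      ≤⟨ s≤s (increasing-spread inc (s≤s⁻¹ i<1+j) (<-trans (n<1+n j) 1+j<n)) ⟩
  suc (f j) + i      ≤⟨ +-monoˡ-≤ i (inc (n<1+n j) 1+j<n) ⟩
  f (suc j) + i      ∎
  where open ≤-Reasoning

-- If y ≤ f p and every f b with b < r lies below z, where p < r ≤ n, then y + r ≤ z + p.
-- (Rows of a containment can only drop by as much as the columns allow.)
increasing-gap : ∀ {n f p r y z} → IncreasingOn n f → p < r → r ≤ n →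
                 y ≤ f p → (∀ {b} → b < r → f b < z) → y + r ≤ z + p
increasing-gap {f = f} {p} {suc q} {y} {z} inc (s≤s p≤q) r≤n y≤fp below = begin
  y + suc q          ≤⟨ +-monoˡ-≤ (suc q) y≤fp ⟩
  f p + suc q        ≡⟨ +-suc (f p) q ⟩
  suc (f p + q)      ≤⟨ s≤s (increasing-spread inc p≤q r≤n) ⟩
  suc (f q) + p      ≤⟨ +-monoˡ-≤ p (below (n<1+n q)) ⟩
  z + p              ∎
  where open ≤-Reasoning

width-part : ∀ l → width l ≡ part l 0
width-part []      = refl
width-part (_ ∷ _) = refl

part-beyond : ∀ l {i} → length l ≤ i → part l i ≡ 0
part-beyond []      _         = refl
part-beyond (_ ∷ l) {suc i} (s≤s le) = part-beyond l le

part-nonzero⇒<length : ∀ l {i} → 0 < part l i → i < length l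
part-nonzero⇒<length []      ()
part-nonzero⇒<length (_ ∷ _) {zero}  _   = s≤s z≤n
part-nonzero⇒<length (_ ∷ l) {suc i} pos = s≤s (part-nonzero⇒<length l pos)

part-All : ∀ {P : ℕ → Set} {l} → All P l → P 0 → ∀ i → P (part l i)
part-All []       p0 _       = p0
part-All (px ∷ _) _  zero    = px
part-All (_ ∷ pl) p0 (suc i) = part-All pl p0 i

width-bound : ∀ {l} → Sorted l → All (_≤ width l) l
width-bound {[]}    _ = []
width-bound {_ ∷ _} L = Linked⇒All (λ p q → ≤-trans q p) ≤-refl L

part≤width : ∀ {l} → Sorted l → ∀ i → part l i ≤ width l
part≤width L = part-All (width-bound L) z≤n

positive-part : ∀ {l} → All (0 <_) l → ∀ {i} → i < length l → 0 < part l i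
positive-part (x>0 ∷ _)  {zero}  _         = x>0
positive-part (_ ∷ l>0) {suc i} (s≤s i<n) = positive-part l>0 i<n

width-≤ : ∀ {l t} → All (_≤ t) l → width l ≤ t
width-≤ []        = z≤n
width-≤ (x≤t ∷ _) = x≤t

part-antitone : ∀ {l} → Sorted l → ∀ {i j} → i ≤ j → part l j ≤ part l i
part-antitone {[]}    _ _ = z≤n
part-antitone {_ ∷ _} L {zero}  {j}     _         = part≤width L j
part-antitone {_ ∷ _} L {suc i} {suc j} (s≤s i≤j) = part-antitone (Linked.tail L) i≤j

sorted-from-parts : ∀ l → (∀ i → part l (suc i) ≤ part l i) → Sorted l
sorted-from-parts []          _    = []
sorted-from-parts (_ ∷ [])    _    = [-]
sorted-from-parts (_ ∷ y ∷ l) step = step 0 ∷ sorted-from-parts (y ∷ l) (λ i → step (suc i))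

positive-ext : ∀ {xs ys} → All (0 <_) xs → All (0 <_) ys →
               (∀ i → part xs i ≡ part ys i) → xs ≡ ys
positive-ext []         []         _  = refl
positive-ext []         (y>0 ∷ _)  eq = contradiction (sym (eq 0)) (>⇒≢ y>0)
positive-ext (x>0 ∷ _)  []         eq = contradiction (eq 0) (>⇒≢ x>0)
positive-ext (_ ∷ xs>0) (_ ∷ ys>0) eq = cong₂ _∷_ (eq 0) (positive-ext xs>0 ys>0 (λ i → eq (suc i)))

part-⊕ : ∀ xs ys i → part (xs ⊕ ys) i ≡ part xs i + part ys i
part-⊕ []       _        _       = refl
part-⊕ (_ ∷ _)  []       _       = sym (+-identityʳ _)
part-⊕ (_ ∷ _)  (_ ∷ _)  zero    = refl
part-⊕ (_ ∷ xs) (_ ∷ ys) (suc i) = part-⊕ xs ys i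

width-⊕ : ∀ xs ys → width (xs ⊕ ys) ≡ width xs + width ys
width-⊕ xs ys rewrite width-part (xs ⊕ ys) | width-part xs | width-part ys = part-⊕ xs ys 0

⊕-positive : ∀ {xs ys} → All (0 <_) xs → All (0 <_) ys → All (0 <_) (xs ⊕ ys)
⊕-positive []          ys>0        = ys>0
⊕-positive xs>0@(_ ∷ _) []         = xs>0
⊕-positive (x>0 ∷ xs>0) (_ ∷ ys>0) = ≤-trans x>0 (m≤m+n _ _) ∷ ⊕-positive xs>0 ys>0

⊕-sorted : ∀ {xs ys} → Sorted xs → Sorted ys → Sorted (xs ⊕ ys)
⊕-sorted {xs} {ys} Lx Ly = sorted-from-parts (xs ⊕ ys) λ i →
  subst₂ _≤_ (sym (part-⊕ xs ys (suc i))) (sym (part-⊕ xs ys i))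
    (+-mono-≤ (part-antitone Lx (n≤1+n i)) (part-antitone Ly (n≤1+n i)))

part-applyUpTo : ∀ f n {i} → i < n → part (applyUpTo f n) i ≡ f i
part-applyUpTo f (suc n) {zero}  _         = refl
part-applyUpTo f (suc n) {suc i} (s≤s i<n) = part-applyUpTo (λ j → f (suc j)) n i<n

positives : List ℕ → List ℕ
positives = filter (0 <?_)

part-positives : ∀ {xs} → Sorted xs → ∀ i → part (positives xs) i ≡ part xs i
part-positives {[]}     _ _ = refl
part-positives {x ∷ xs} L i with 0 <? x | i
... | yes x>0 | zero  rewrite filter-accept (0 <?_) {xs = xs} x>0 = refl
... | yes x>0 | suc j rewrite filter-accept (0 <?_) {xs = xs} x>0 = part-positives (Linked.tail L) j
... | no x≯0  | j     rewrite filter-reject (0 <?_) {xs = xs} x≯0 = begin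
  part (positives xs) j  ≡⟨ part-positives (Linked.tail L) j ⟩
  part (x ∷ xs) (suc j)  ≡⟨ vanishes (suc j) ⟩
  0                      ≡⟨ vanishes j ⟨
  part (x ∷ xs) j        ∎
  where
    open ≡-Reasoning
    vanishes : ∀ k → part (x ∷ xs) k ≡ 0
    vanishes k = n≤0⇒n≡0 (≤-trans (part-antitone L {0} {k} z≤n) (≮⇒≥ x≯0))

-- Position in ys of the i-th entry of a sublist xs ⊆ ys.  Indices past the end
-- of xs are sent past the end of ys, so the two lemmas below hold for all i.
index : ∀ {xs ys} → xs ⊆ ys → ℕ → ℕ
index []       i       = i
index (_ ∷ʳ s) i       = suc (index s i)
index (_ ∷ _)  zero    = zero
index (_ ∷ s)  (suc i) = suc (index s i)

index-increasing : ∀ {xs ys} (s : xs ⊆ ys) {i j} → i < j → index s i < index s j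
index-increasing []       i<j       = i<j
index-increasing (_ ∷ʳ s) i<j       = s≤s (index-increasing s i<j)
index-increasing (_ ∷ s)  {zero}  {suc _} _         = s≤s z≤n
index-increasing (_ ∷ s)  {suc _} {suc _} (s≤s i<j) = s≤s (index-increasing s i<j)

index-part : ∀ {xs ys} (s : xs ⊆ ys) i → part ys (index s i) ≡ part xs i
index-part []          _       = refl
index-part (_ ∷ʳ s)    i       = index-part s i
index-part (refl ∷ _)  zero    = refl
index-part (_ ∷ s)     (suc i) = index-part s i

⊆⇒↭++ : ∀ {xs ys : List ℕ} → xs ⊆ ys → ∃ λ zs → ys ↭ xs ++ zs
⊆⇒↭++ [] = [] , ↭-refl
⊆⇒↭++ {xs} (y ∷ʳ s) with ⊆⇒↭++ s
... | zs , p = y ∷ zs , ↭-trans (prep y p) (↭-sym (shift y xs zs))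
⊆⇒↭++ (refl ∷ s) with ⊆⇒↭++ s
... | zs , p = zs , prep _ p

∈⇒↭∷ : ∀ {x : ℕ} {xs} → x ∈ xs → ∃ λ ys → xs ↭ x ∷ ys
∈⇒↭∷ (here refl) = _ , ↭-refl
∈⇒↭∷ {xs = y ∷ _} (there x∈) with ∈⇒↭∷ x∈
... | ys , p = y ∷ ys , ↭-trans (prep y p) (swap y _ ↭-refl)

-- If a sorted list β is a rearrangement of γ ++ ν with γ sorted, then γ occurs
-- in β as a sublist: scanning β, each head either starts γ or belongs to ν.
sorted-⊆ : ∀ {β γ ν} → Sorted β → Sorted γ → β ↭ γ ++ ν → γ ⊆ β
sorted-⊆ {β}     {[]}    _  _  _ = minimum β
sorted-⊆ {[]}    {_ ∷ _} _  _  p = contradiction (↭-sym p) ¬x∷xs↭[]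
sorted-⊆ {b ∷ β} {g ∷ γ} {ν} Lβ Lγ p with g ≟ b
... | yes refl = refl ∷ sorted-⊆ (Linked.tail Lβ) (Linked.tail Lγ) (drop-∷ p)
... | no g≢b with ∈-++⁻ (g ∷ γ) (∈-resp-↭ p (here refl))
...   | inj₁ b∈γ = contradiction (≤-antisym g≤b (All.lookup (width-bound Lγ) b∈γ)) g≢b
  where
    g≤b : g ≤ b
    g≤b = All.lookup (width-bound Lβ) (∈-resp-↭ (↭-sym p) (here refl))
...   | inj₂ b∈ν with ∈⇒↭∷ b∈ν
...     | ν′ , ν↭ = b ∷ʳ sorted-⊆ (Linked.tail Lβ) Lγ (drop-∷ (↭-trans p b∷rest))
  where
    b∷rest : (g ∷ γ) ++ ν ↭ b ∷ (g ∷ γ) ++ ν′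
    b∷rest = ↭-trans (++⁺ˡ (g ∷ γ) ν↭) (shift b (g ∷ γ) ν′)

applyUpTo-part-∷ : ∀ b β n f → (∀ {i} → i < n → 0 < f i) →
                   applyUpTo (λ i → part (b ∷ β) (f i)) n ≡ applyUpTo (λ i → part β (pred (f i))) n
applyUpTo-part-∷ b β zero    f _   = refl
applyUpTo-part-∷ b β (suc n) f pos =
  cong₂ _∷_ (part-∷ (pos (s≤s z≤n))) (applyUpTo-part-∷ b β n (λ i → f (suc i)) (λ i<n → pos (s≤s i<n)))
  where
    part-∷ : ∀ {j} → 0 < j → part (b ∷ β) j ≡ part β (pred j)
    part-∷ {suc _} _ = refl

increasing-pred : ∀ {n f} → IncreasingOn n f → (∀ {i} → i < n → 0 < f i) →
                  IncreasingOn n (λ i → pred (f i))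
increasing-pred inc pos i<j j<n = pred-mono-< {{>-nonZero (pos (<-trans i<j j<n))}} (inc i<j j<n)

pred-bound : ∀ {m l} → 0 < m → m < suc l → pred m < l
pred-bound {suc _} _ m<1+l = s≤s⁻¹ m<1+l

select : ∀ β n f → IncreasingOn n f → (∀ {i} → i < n → f i < length β) →
         applyUpTo (λ i → part β (f i)) n ⊆ β
select β       zero    _ _   _     = minimum β
select []      (suc n) _ _   bound = contradiction (bound (s≤s z≤n)) λ ()
select (b ∷ β) (suc n) f inc bound with f 0 ≟ 0
... | yes f0≡0 rewrite f0≡0 = refl ∷ subst (_⊆ β) (sym (applyUpTo-part-∷ b β n g pos))
        (select β n (λ i → pred (g i)) (increasing-pred inc-g pos) λ i<n → pred-bound (pos i<n) (bound (s≤s i<n)))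
  where
    g : ℕ → ℕ
    g i = f (suc i)
    inc-g : IncreasingOn n g
    inc-g i<j j<n = inc (s≤s i<j) (s≤s j<n)
    pos : ∀ {i} → i < n → 0 < g i
    pos i<n = subst (_< g _) f0≡0 (inc (s≤s z≤n) (s≤s i<n))
... | no f0≢0 = b ∷ʳ subst (_⊆ β) (sym (applyUpTo-part-∷ b β (suc n) f pos))
        (select β (suc n) (λ i → pred (f i)) (increasing-pred inc pos) λ i<n → pred-bound (pos i<n) (bound i<n))
  where
    pos : ∀ {i} → i < suc n → 0 < f i
    pos {zero}  _   = n≢0⇒n>0 f0≢0
    pos {suc i} i<n = ≤-<-trans z≤n (inc (s≤s z≤n) i<n)

-- An embedding of the Ferrers board of μ into that of β, with rows and columns
-- indexed by ℕ: the data of `Contains β μ`, without the bookkeeping of Fin.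
record Embedding (β μ : List ℕ) : Set where
  field
    row col        : ℕ → ℕ
    row-increasing : IncreasingOn (height μ) row
    col-increasing : IncreasingOn (width μ) col
    cell           : ∀ {a b} → a < height μ → b < width μ →
                     (col b < part β (row a)) ⇔ (b < part μ a)

embedding⇒contains : ∀ {β μ} → Embedding β μ → Contains β μ
embedding⇒contains E =
  (λ a → row (toℕ a)) , (λ b → col (toℕ b)) ,
  (λ a b a<b → row-increasing a<b (toℕ<n b)) , (λ a b a<b → col-increasing a<b (toℕ<n b)) ,
  (λ a b → cell (toℕ<n a) (toℕ<n b))
  where open Embedding E

extend : ∀ {m} → (Fin m → ℕ) → ℕ → ℕ
extend {m} f i with i <? m
... | yes i<m = f (fromℕ< i<m)
... | no  _   = 0

extend-fromℕ< : ∀ {m i} (f : Fin m → ℕ) (i<m : i < m) → extend f i ≡ f (fromℕ< i<m)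
extend-fromℕ< {m} {i} f i<m with i <? m
... | yes i<m′ = cong (λ p → f (fromℕ< p)) (<-irrelevant i<m′ i<m)
... | no  i≮m  = contradiction i<m i≮m

extend-increasing : ∀ {m} {f : Fin m → ℕ} → StrictlyIncreasing f → IncreasingOn m (extend f)
extend-increasing {m} {f} inc {i} {j} i<j j<m =
  subst₂ _<_ (sym (extend-fromℕ< f i<m)) (sym (extend-fromℕ< f j<m))
    (inc (fromℕ< i<m) (fromℕ< j<m) (subst₂ _<_ (sym (toℕ-fromℕ< i<m)) (sym (toℕ-fromℕ< j<m)) i<j))
  where
    i<m : i < m
    i<m = <-trans i<j j<m

contains⇒embedding : ∀ {β μ} → Contains β μ → Embedding β μ
contains⇒embedding {β} {μ} (r , c , r-inc , c-inc , cell) = record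
  { row            = extend r
  ; col            = extend c
  ; row-increasing = extend-increasing r-inc
  ; col-increasing = extend-increasing c-inc
  ; cell           = cell′
  }
  where
    cell′ : ∀ {a b} → a < height μ → b < width μ →
            (extend c b < part β (extend r a)) ⇔ (b < part μ a)
    cell′ {a} {b} a<n b<w =
      subst₂ (λ x y → (x < part β y) ⇔ (b < part μ a))
        (sym (extend-fromℕ< c b<w)) (sym (extend-fromℕ< r a<n))
        (subst₂ (λ x y → (c (fromℕ< b<w) < part β (r (fromℕ< a<n))) ⇔ (x < part μ y))
          (toℕ-fromℕ< b<w) (toℕ-fromℕ< a<n) (cell (fromℕ< a<n) (fromℕ< b<w)))

-- The first kept row may always be taken to be the top row of β: every column
-- of μ meets the top row of μ, and the top row of β is the longest.
anchor : ∀ {β μ} → Sorted β → 0 < height μ → Embedding β μ →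
         Σ (Embedding β μ) (λ E → Embedding.row E 0 ≡ 0)
anchor {β} {μ} Lβ h>0 E = record
  { row            = row′
  ; col            = col
  ; row-increasing = row′-increasing
  ; col-increasing = col-increasing
  ; cell           = cell′
  } , refl
  where
    open Embedding E
    row′ : ℕ → ℕ
    row′ zero    = 0
    row′ (suc a) = row (suc a)
    row′-increasing : IncreasingOn (height μ) row′
    row′-increasing {zero}  {suc _} _   j<n = ≤-<-trans z≤n (row-increasing (s≤s z≤n) j<n)
    row′-increasing {suc _} {suc _} i<j j<n = row-increasing i<j j<n
    cell′ : ∀ {a b} → a < height μ → b < width μ → (col b < part β (row′ a)) ⇔ (b < part μ a)
    cell′ {zero}  {b} _   b<w = mk⇔ (λ _ → b<μ₀)
      (λ _ → <-≤-trans (Equivalence.from (cell h>0 b<w) b<μ₀) (part-antitone Lβ z≤n))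
      where
        b<μ₀ : b < part μ 0
        b<μ₀ = subst (b <_) (width-part μ) b<w
    cell′ {suc _} a<n b<w = cell a<n b<w

embedding-⊆ : ∀ {xs β μ} → xs ⊆ β → Embedding xs μ → Embedding β μ
embedding-⊆ s E = record
  { row            = λ a → index s (row a)
  ; col            = col
  ; row-increasing = λ i<j j<n → index-increasing s (row-increasing i<j j<n)
  ; col-increasing = col-increasing
  ; cell           = λ {a} a<n b<w →
      subst (λ x → (col _ < x) ⇔ _) (sym (index-part s (row a))) (cell a<n b<w)
  }
  where open Embedding E

-- conjugate μ b is the number of leading parts of μ exceeding b; for a
-- partition μ it is the (b+1)-st part of the conjugate partition μ′.
conjugate : List ℕ → ℕ → ℕ
conjugate []       _ = 0
conjugate (x ∷ xs) b with b <? x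
... | yes _ = suc (conjugate xs b)
... | no  _ = 0

<conjugate⇒ : ∀ μ {i b} → i < conjugate μ b → b < part μ i
<conjugate⇒ (x ∷ xs) {i} {b} i<c with b <? x | i | i<c
... | yes b<x | zero  | _         = b<x
... | yes _   | suc _ | s≤s j<c   = <conjugate⇒ xs j<c

>⇒<conjugate : ∀ {μ} → Sorted μ → ∀ {i b} → b < part μ i → i < conjugate μ b
>⇒<conjugate {x ∷ xs} L {i} {b} b<μi with b <? x | i
... | yes _   | zero  = s≤s z≤n
... | yes _   | suc j = s≤s (>⇒<conjugate (Linked.tail L) b<μi)
... | no  b≮x | j     = contradiction (<-≤-trans b<μi (part-antitone L {0} {j} z≤n)) b≮x

conjugate-antitone : ∀ {μ} → Sorted μ → ∀ {b b′} → b ≤ b′ → conjugate μ b′ ≤ conjugate μ b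
conjugate-antitone {μ} L {b} {b′} b≤b′ = ≮⇒≥ λ c<c′ →
  <-irrefl refl (>⇒<conjugate L (≤-<-trans b≤b′ (<conjugate⇒ μ c<c′)))

-- μ embeds into μ ⊕ α through all rows, column b going to b + α_{μ′_b}: the
-- cells of row a are shifted right exactly by α_a, and α_{μ′_b} ≤ α_a iff b < μ_a.
⊕-embedding : ∀ {μ α} → Sorted μ → Sorted α → Embedding (μ ⊕ α) μ
⊕-embedding {μ} {α} Lμ Lα = record
  { row            = λ a → a
  ; col            = col
  ; row-increasing = λ i<j _ → i<j
  ; col-increasing = λ i<j _ →
      +-mono-<-≤ i<j (part-antitone Lα (conjugate-antitone Lμ (<⇒≤ i<j)))
  ; cell           = λ {a} {b} _ _ → subst (λ x → (col b < x) ⇔ (b < part μ a))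
      (sym (part-⊕ μ α a)) (mk⇔ (shifted-to a b) (shifted-from a b))
  }
  where
    col : ℕ → ℕ
    col b = b + part α (conjugate μ b)
    shifted-from : ∀ a b → b < part μ a → col b < part μ a + part α a
    shifted-from a b b<μa =
      +-mono-<-≤ b<μa (part-antitone Lα (<⇒≤ (>⇒<conjugate Lμ b<μa)))
    shifted-to : ∀ a b → col b < part μ a + part α a → b < part μ a
    shifted-to a b lt = decidable-stable (b <? part μ a) λ b≮μa →
      <⇒≱ lt (+-mono-≤ (≮⇒≥ b≮μa)
        (part-antitone Lα (≮⇒≥ λ a<c → b≮μa (<conjugate⇒ μ a<c))))

-- The excess
-- decreases, so α = (excess without zeros) is a partition and μ ⊕ α is the list
-- `kept` of selected parts, a sublist of β.
module Excess {β μ : List ℕ} (Pβ : IsPartition β) (Pμ : IsPartition μ)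
              (E : Embedding β μ) where
  open Embedding E

  selected : ℕ → ℕ
  selected a = part β (row a)

  excess : ℕ → ℕ
  excess a = selected a ∸ part μ a

  μ≤w : ∀ a → part μ a ≤ width μ
  μ≤w = part≤width (proj₂ Pμ)

  col<selected : ∀ {a b} → a < height μ → b < part μ a → col b < selected a
  col<selected a<n b<μa = Equivalence.from (cell a<n (<-≤-trans b<μa (μ≤w _))) b<μa

  selected≤col : ∀ {a} → a < height μ → part μ a < width μ → selected a ≤ col (part μ a)
  selected≤col a<n μa<w = ≮⇒≥ λ lt → <-irrefl refl (Equivalence.to (cell a<n μa<w) lt)

  -- Row a of β is at least as long as row a of μ (gap estimate from column 0).
  part≤selected : ∀ {a} → a < height μ → part μ a ≤ selected a
  part≤selected {a} a<n = subst (part μ a ≤_) (+-identityʳ (selected a))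
    (increasing-gap col-increasing (positive-part (proj₁ Pμ) a<n) (μ≤w a) z≤n (col<selected a<n))

  -- If μ_{a+1} = μ_a, the excess drops because β does; if μ_{a+1} < μ_a, row a+1
  -- of β ends before column col μ_{a+1} while row a reaches past col (μ_a − 1),
  -- and the columns in between are spread at least μ_a − μ_{a+1} − 1 apart.
  excess-antitone : ∀ {a} → suc a < height μ → excess (suc a) ≤ excess a
  excess-antitone {a} 1+a<n with part μ (suc a) <? part μ a
  ... | yes μ₁<μ₀ = ∸-cross {selected (suc a)} {selected a}
        (increasing-gap col-increasing μ₁<μ₀ (μ≤w a)
          (selected≤col 1+a<n (<-≤-trans μ₁<μ₀ (μ≤w a)))
          (col<selected (<-trans (n<1+n a) 1+a<n)))
  ... | no  μ₁≮μ₀ = ∸-mono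
        (part-antitone (proj₂ Pβ) (<⇒≤ (row-increasing (n<1+n a) 1+a<n))) (≮⇒≥ μ₁≮μ₀)

  kept excesses α : List ℕ
  kept     = applyUpTo selected (height μ)
  excesses = applyUpTo excess (height μ)
  α        = positives excesses

  kept⊆β : kept ⊆ β
  kept⊆β = select β (height μ) row row-increasing λ a<n →
    part-nonzero⇒<length β (<-≤-trans (positive-part (proj₁ Pμ) a<n) (part≤selected a<n))

  excesses-sorted : Sorted excesses
  excesses-sorted = applyUpTo⁺₁ excess (height μ) excess-antitone

  α-partition : IsPartition α
  α-partition = all-filter (0 <?_) excesses , filter⁺ (0 <?_) (λ p q → ≤-trans q p) excesses-sorted

  α-height : height α ≤ height μ
  α-height = ≤-trans (length-filter (0 <?_) excesses) (≤-reflexive (length-applyUpTo excess (height μ)))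

  α-width : row 0 ≡ 0 → 0 < height μ → width α ≡ width β ∸ width μ
  α-width row₀≡0 n>0 = begin
    width α                 ≡⟨ width-part α ⟩
    part α 0                ≡⟨ part-positives excesses-sorted 0 ⟩
    part excesses 0         ≡⟨ part-applyUpTo excess (height μ) n>0 ⟩
    part β (row 0) ∸ part μ 0 ≡⟨ cong₂ (λ i m → part β i ∸ m) row₀≡0 (sym (width-part μ)) ⟩
    part β 0 ∸ width μ      ≡⟨ cong (_∸ width μ) (width-part β) ⟨
    width β ∸ width μ       ∎
    where open ≡-Reasoning

  μ⊕α≡kept : μ ⊕ α ≡ kept
  μ⊕α≡kept = positive-ext (⊕-positive (proj₁ Pμ) (proj₁ α-partition)) (All-resp-⊆ kept⊆β (proj₁ Pβ)) parts
    where
      open ≡-Reasoning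
      parts : ∀ i → part (μ ⊕ α) i ≡ part kept i
      parts i with i <? height μ
      ... | yes i<n = begin
        part (μ ⊕ α) i                ≡⟨ part-⊕ μ α i ⟩
        part μ i + part α i           ≡⟨ cong (part μ i +_) (part-positives excesses-sorted i) ⟩
        part μ i + part excesses i    ≡⟨ cong (part μ i +_) (part-applyUpTo excess (height μ) i<n) ⟩
        part μ i + excess i           ≡⟨ m+[n∸m]≡n (part≤selected i<n) ⟩
        selected i                    ≡⟨ part-applyUpTo selected (height μ) i<n ⟨
        part kept i                   ∎
      ... | no i≮n = begin
        part (μ ⊕ α) i                ≡⟨ part-⊕ μ α i ⟩
        part μ i + part α i           ≡⟨ cong₂ _+_ (part-beyond μ (≮⇒≥ i≮n)) (part-positives excesses-sorted i) ⟩
        part excesses i               ≡⟨ beyond excess ⟩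
        0                             ≡⟨ beyond selected ⟨
        part kept i                   ∎
        where
          beyond : ∀ f → part (applyUpTo f (height μ)) i ≡ 0
          beyond f = part-beyond (applyUpTo f (height μ))
            (subst (_≤ i) (sym (length-applyUpTo f (height μ))) (≮⇒≥ i≮n))

rearranged-width : ∀ {β γ ν} → Sorted β → Sorted γ → All (_≤ width γ) ν →
                   β ↭ γ ++ ν → γ ⊆ β → width β ≡ width γ
rearranged-width Lβ Lγ ν≤ p γ⊆β = ≤-antisym
  (width-≤ (All-resp-↭ (↭-sym p) (++⁺ (width-bound Lγ) ν≤)))
  (width-≤ (All-resp-⊆ γ⊆β (width-bound Lβ)))

nonempty : ∀ μ → 0 < width μ → 0 < height μ
nonempty (_ ∷ _) _ = s≤s z≤n

containment⇒decomposition : ∀ h k μ β → IsPartition μ → 0 < width μ → height μ ≤ h →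
  InPμk μ k β → Σ (List ℕ) (λ α → InPhk h k α × InQ (μ ⊕ α) β)
containment⇒decomposition h k μ β Pμ wμ>0 hμ≤h (Pβ , wβ , μ⊆β)
  with anchor (proj₂ Pβ) (nonempty μ wμ>0) (contains⇒embedding μ⊆β)
... | E , row₀≡0 = α , (α-partition , ≤-trans α-height hμ≤h , α-width-k) ,
      Pβ , ν , ν≤ , subst (λ γ → β ↭ γ ++ ν) (sym μ⊕α≡kept) β↭
  where
    open Excess Pβ Pμ E
    open ≡-Reasoning
    α-width-k : width α ≡ k
    α-width-k = begin
      width α                    ≡⟨ α-width row₀≡0 (nonempty μ wμ>0) ⟩
      width β ∸ width μ          ≡⟨ cong (_∸ width μ) wβ ⟩
      (width μ + k) ∸ width μ    ≡⟨ m+n∸m≡n (width μ) k ⟩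
      k                          ∎
    width-μ⊕α : width (μ ⊕ α) ≡ width β
    width-μ⊕α = begin
      width (μ ⊕ α)              ≡⟨ width-⊕ μ α ⟩
      width μ + width α          ≡⟨ cong (width μ +_) α-width-k ⟩
      width μ + k                ≡⟨ wβ ⟨
      width β                    ∎
    ν : List ℕ
    ν = proj₁ (⊆⇒↭++ kept⊆β)
    β↭ : β ↭ kept ++ ν
    β↭ = proj₂ (⊆⇒↭++ kept⊆β)
    ν≤ : All (_≤ width (μ ⊕ α)) ν
    ν≤ = subst (λ t → All (_≤ t) ν) (sym width-μ⊕α)
      (++⁻ʳ kept (All-resp-↭ β↭ (width-bound (proj₂ Pβ))))

decomposition⇒containment : ∀ h k μ α β → IsPartition μ → InPhk h k α → InQ (μ ⊕ α) β → InPμk μ k β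
decomposition⇒containment h k μ α β (_ , Lμ) ((_ , Lα) , _ , wα) (Pβ , ν , ν≤ , p) =
  Pβ , width-β , embedding⇒contains (embedding-⊆ μ⊕α⊆β (⊕-embedding Lμ Lα))
  where
    μ⊕α⊆β : μ ⊕ α ⊆ β
    μ⊕α⊆β = sorted-⊆ (proj₂ Pβ) (⊕-sorted Lμ Lα) p
    width-β : width β ≡ width μ + k
    width-β = trans (rearranged-width (proj₂ Pβ) (⊕-sorted Lμ Lα) ν≤ p μ⊕α⊆β)
                    (trans (width-⊕ μ α) (cong (width μ +_) wα))

lemma2p3 : (h k : ℕ) → 0 < h → 0 < k → (μ : List ℕ) → IsPartition μ → 0 < width μ → height μ ≤ h →
             (β : List ℕ) → InPμk μ k β ⇔ Σ (List ℕ) (λ α → InPhk h k α × InQ (μ ⊕ α) β)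
lemma2p3 h k _ _ μ Pμ wμ>0 hμ≤h β = mk⇔
  (containment⇒decomposition h k μ β Pμ wμ>0 hμ≤h)
  (λ (α , α∈Phk , β∈Q) → decomposition⇒containment h k μ α β Pμ α∈Phk β∈Q)
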